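{- (i) Every orthogonal pseudo-orthomodular poset is orthomodular. (ii) Every orthogonal modular poset with complementation is orthomodular.
   Context: For a poset $(P,\leq)$ and $A\subseteq P$ let $L(A)=\{x\in P\mid x\leq y\text{ for all }y\in A\}$ and $U(A)=\{x\in P\mid y\leq x\text{ for all }y\in A\}$; we write $L(a,b)$ for $L(\{a,b\})$, $L(A,a)$ for $L(A\cup\{a\})$, etc., and similarly for $U$. A poset is modular if for all $x,y,z$, $x\leq z$ implies $L(U(x,y),z)=L(U(x,L(y,z)))$. A poset with complementation is $(P,\leq,{}',0,1)$ with $(P,\leq,0,1)$ a bounded poset and $'$ a unary operation such that $L(x,x')=\{0\}$, $U(x,x')=\{1\}$, $x\leq y$ implies $y'\leq x'$, and $(x')'=x$. A pseudo-orthomodular poset is a poset with complementation satisfying $L(U(L(x,y),y'),y)=L(x,y)$ for all $x,y$. An orthogonal poset is a poset with complementation in which $x\leq y'$ implies that $x\vee y$ exists; consequently, if $x\leq y$ then $x\vee y'$ and $(x\vee y')\wedge y$ exist. An orthomodular poset is an orthogonal poset satisfying the orthomodular law: for all $x\leq y$, $(x\vee y')\wedge y=x$ (equivalently, $((x\wedge y)\vee y')\wedge y=x\wedge y$ and $((x\vee y)\wedge y')\vee y=x\vee y$ wherever these are formed in the orthogonal poset). -}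

module Defs where

open import Level using (Level; suc)
open import Data.Product using (Σ; _×_; _,_)
open import Data.Sum using (_⊎_)
open import Relation.Binary.PropositionalEquality using (_≡_)

Subset : ∀ {c} → Set c → Set (suc c)
Subset {c} A = A → Set c

module _ {c} {A : Set c} where
  _≐_ : Subset A → Subset A → Set c
  S ≐ T = ∀ z → (S z → T z) × (T z → S z)

  sing : A → Subset A
  sing a z = z ≡ a

  pair : A → A → Subset A
  pair a b z = z ≡ a ⊎ z ≡ b

  _∪_ : Subset A → Subset A → Subset A
  (S ∪ T) z = S z ⊎ T z

record PosetWithComplementation (c : Level) : Set (suc c) where
  field
    Carrier : Set c
    _≤_     : Carrier → Carrier → Set c
    ≤-refl    : ∀ x → x ≤ x
    ≤-trans   : ∀ {x y z} → x ≤ y → y ≤ z → x ≤ z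
    ≤-antisym : ∀ {x y} → x ≤ y → y ≤ x → x ≡ y
    𝟘 𝟙     : Carrier
    𝟘-least    : ∀ x → 𝟘 ≤ x
    𝟙-greatest : ∀ x → x ≤ 𝟙
    _′      : Carrier → Carrier

  L : Subset Carrier → Subset Carrier
  L S x = ∀ y → S y → x ≤ y

  U : Subset Carrier → Subset Carrier
  U S x = ∀ y → S y → y ≤ x

  field
    L-compl  : ∀ x → L (pair x (x ′)) ≐ (sing (𝟘))
    U-compl  : ∀ x → U (pair x (x ′)) ≐ (sing (𝟙))
    ′-antitone : ∀ {x y} → x ≤ y → (y ′) ≤ (x ′)
    ′-involutive : ∀ x → (x ′) ′ ≡ x

  IsJoin : Carrier → Carrier → Carrier → Set c
  IsJoin x y s = (x ≤ s × y ≤ s) × (∀ t → x ≤ t → y ≤ t → s ≤ t)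

  IsMeet : Carrier → Carrier → Carrier → Set c
  IsMeet x y m = (m ≤ x × m ≤ y) × (∀ t → t ≤ x → t ≤ y → t ≤ m)

module _ {c} (P : PosetWithComplementation c) where
  open PosetWithComplementation P

  Orthogonal : Set c
  Orthogonal = ∀ x y → x ≤ (y ′) → Σ Carrier (IsJoin x y)

  Modular : Set c
  Modular = ∀ x y z → x ≤ z →
    L (U (pair x (y)) ∪ (sing (z))) ≐ L (U ((sing (x)) ∪ L (pair y (z))))

  PseudoOrthomodular : Set c
  PseudoOrthomodular = ∀ x y →
    L (U (L (pair x (y)) ∪ (sing (y ′))) ∪ (sing (y))) ≐ L (pair x (y))

  -- orthomodular law: x ≤ y implies (x ∨ y') ∧ y = x
  -- (joins/meets are unique, so we quantify over all witnesses)
  OrthomodularLaw : Set c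
  OrthomodularLaw = ∀ x y → x ≤ y → ∀ s → IsJoin x (y ′) s →
    ∀ m → IsMeet s y m → m ≡ x

  Orthomodular : Set c
  Orthomodular = Orthogonal × OrthomodularLaw

-- Let x ≤ y in an orthogonal poset, s = x ∨ y′ and m = s ∧ y.  Always x ≤ m,
-- so the orthomodular law m = x reduces to m ≤ x.  Since m is below every
-- upper bound of {x, y′} (it is below s) and below y, m lies in the cone
-- C(x,y) = L(U(x,y′),y).  Hence it suffices to show that every element of
-- C(x,y) is below x (lemma `law-from-cone-bound`).
--   (i)  In a pseudo-orthomodular poset, U(L(x,y),y′) ⊆ U(x,y′) because
--        x ∈ L(x,y); by antitonicity of L the cone C(x,y) is contained in
--        L(U(L(x,y),y′),y) = L(x,y), all of whose elements are below x.
--   (ii) In a modular poset, C(x,y) = L(U(x,L(y′,y))) = L(U(x,0)), and x is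
--        an upper bound of {x} ∪ L(y′,y) because L(y′,y) = {0}.
module Submission where

open import Defs
open import Level using (Level)
open import Data.Product using (_×_; _,_; proj₁)
open import Data.Sum using (inj₁; inj₂)
open import Relation.Binary.PropositionalEquality using (_≡_; refl; subst; sym)
open import Relation.Unary using (_⊆_)

module _ {c : Level} (P : PosetWithComplementation c) where
  open PosetWithComplementation P

  L-antitone : ∀ {S T : Subset Carrier} → S ⊆ T → L T ⊆ L S
  L-antitone S⊆T w∈LT y y∈S = w∈LT y (S⊆T y∈S)

  U-antitone : ∀ {S T : Subset Carrier} → S ⊆ T → U T ⊆ U S
  U-antitone S⊆T w∈UT y y∈S = w∈UT y (S⊆T y∈S)

  lower-in-L-pair : ∀ {x y} → x ≤ y → L (pair x y) x
  lower-in-L-pair {x} _   .x (inj₁ refl) = ≤-refl x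
  lower-in-L-pair     x≤y _  (inj₂ refl) = x≤y

  L-pair-compl-is-𝟘 : ∀ y {w} → L (pair (y ′) y) w → w ≡ 𝟘
  L-pair-compl-is-𝟘 y {w} w∈L = proj₁ (L-compl y w) w∈L-swapped
    where
    w∈L-swapped : L (pair y (y ′)) w
    w∈L-swapped z (inj₁ z≡y)  = w∈L z (inj₂ z≡y)
    w∈L-swapped z (inj₂ z≡y′) = w∈L z (inj₁ z≡y′)

  OMCone : Carrier → Carrier → Subset Carrier
  OMCone x y = L (U (pair x (y ′)) ∪ sing y)

  meet-in-OMCone : ∀ {x y s m} → IsJoin x (y ′) s → IsMeet s y m → OMCone x y m
  meet-in-OMCone {x} {y} ((_ , _) , s-least) ((m≤s , _) , _) w (inj₁ w∈U) =
    ≤-trans m≤s (s-least w (w∈U x (inj₁ refl)) (w∈U (y ′) (inj₂ refl)))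
  meet-in-OMCone (_ , _) ((_ , m≤y) , _) _ (inj₂ refl) = m≤y

  law-from-cone-bound : (∀ {x y} → x ≤ y → OMCone x y ⊆ (_≤ x)) → OrthomodularLaw P
  law-from-cone-bound bound x y x≤y s s-join m m-meet =
    ≤-antisym (bound x≤y (meet-in-OMCone s-join m-meet)) (x≤m s-join m-meet)
    where
    x≤m : IsJoin x (y ′) s → IsMeet s y m → x ≤ m
    x≤m ((x≤s , _) , _) (_ , m-greatest) = m-greatest x x≤s x≤y

  pseudo-orthomodular-cone-bound : PseudoOrthomodular P →
    ∀ {x y} → x ≤ y → OMCone x y ⊆ (_≤ x)
  pseudo-orthomodular-cone-bound pom {x} {y} x≤y w∈cone =
    proj₁ (pom x y _) (L-antitone widen w∈cone) x (inj₁ refl)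
    where
    U-shrinks : U (L (pair x y) ∪ sing (y ′)) ⊆ U (pair x (y ′))
    U-shrinks = U-antitone λ { (inj₁ refl) → inj₁ (lower-in-L-pair x≤y)
                             ; (inj₂ refl) → inj₂ refl }

    widen : U (L (pair x y) ∪ sing (y ′)) ∪ sing y ⊆ U (pair x (y ′)) ∪ sing y
    widen (inj₁ u∈U) = inj₁ (U-shrinks u∈U)
    widen (inj₂ u≡y) = inj₂ u≡y

  modular-cone-bound : Modular P → ∀ {x y} → x ≤ y → OMCone x y ⊆ (_≤ x)
  modular-cone-bound mod {x} {y} x≤y w∈cone =
    proj₁ (mod x (y ′) y x≤y _) w∈cone x x-upper
    where
    x-upper : U (sing x ∪ L (pair (y ′) y)) x
    x-upper .x (inj₁ refl) = ≤-refl x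
    x-upper z  (inj₂ z∈L)  = subst (_≤ x) (sym (L-pair-compl-is-𝟘 y z∈L)) (𝟘-least x)

theorem3 : ∀ {c : Level} (P : PosetWithComplementation c) →
    ((Orthogonal P → PseudoOrthomodular P → Orthomodular P)
    × (Orthogonal P → Modular P → Orthomodular P))
theorem3 P =
    (λ orth pom → orth , law-from-cone-bound P (pseudo-orthomodular-cone-bound P pom))
  , (λ orth mod → orth , law-from-cone-bound P (modular-cone-bound P mod))
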